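{- Let $k$ be a positive integer. If there exists a $K_{2,2}$-free graph in $\mathsf{PRIG}$ with $n$ vertices and $m$ edges, then there exists a $K_{k,k}$-free graph in $\mathsf{PRIG}$ with $(k-1)n$ vertices and $(k-1)^2 m$ edges.
   Context: $\mathsf{PRIG}$ is the class of bipartite graphs $G=(U\cup V,E)$ admitting a map of $U$ to points and $V$ to axis-aligned rectangles in $\mathbb{R}^2$ such that $uv\in E$ iff the point lies in the rectangle. "$K_{k,k}$-free" means not containing the complete bipartite graph $K_{k,k}$ as a subgraph.
   Formalization: The points and rectangles representing graphs in PRIG have rational coordinates rather than coordinates in ℝ². -}

module Defs where

open import Data.Nat using (ℕ; _+_)
open import Data.Fin using (Fin)
open import Data.Rational using (ℚ; _≤_)
open import Data.Rational.Properties using (_≤?_)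
open import Data.Product using (Σ; _×_; _,_; proj₁; proj₂)
open import Data.List using (List; length; filter; cartesianProduct; allFin)
open import Relation.Nullary using (¬_; Dec)
open import Relation.Nullary.Decidable using (_×-dec_)
open import Function.Definitions using (Injective)
open import Relation.Binary.PropositionalEquality using (_≡_)

Point : Set
Point = ℚ × ℚ

record Rect : Set where
  constructor rect
  field
    xlo xhi ylo yhi : ℚ

open Rect public

_∈R_ : Point → Rect → Set
(px , py) ∈R r = (xlo r ≤ px × px ≤ xhi r) × (ylo r ≤ py × py ≤ yhi r)

_∈R?_ : (p : Point) → (r : Rect) → Dec (p ∈R r)
(px , py) ∈R? r = ((xlo r ≤? px) ×-dec (px ≤? xhi r)) ×-dec ((ylo r ≤? py) ×-dec (py ≤? yhi r))

-- A graph in PRIG, given by its representation: U = Fin a mapped to points,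
-- V = Fin b mapped to rectangles; uv is an edge iff point u lies in rectangle v.
record PRIG : Set where
  field
    a b   : ℕ
    point : Fin a → Point
    box   : Fin b → Rect

  Adj : Fin a → Fin b → Set
  Adj u v = point u ∈R box v

  numVertices : ℕ
  numVertices = a + b

  numEdges : ℕ
  numEdges = length (filter (λ e → point (proj₁ e) ∈R? box (proj₂ e))
                            (cartesianProduct (allFin a) (allFin b)))

open PRIG public

-- G contains K_{k,k} as a subgraph: k distinct vertices of U and k distinct
-- vertices of V, pairwise adjacent (G is bipartite and K_{k,k} is connected,
-- so any copy has its sides in U and V respectively).
ContainsKkk : ℕ → PRIG → Set
ContainsKkk k G =
  Σ (Fin k → Fin (a G)) λ f → Σ (Fin k → Fin (b G)) λ g →
    Injective _≡_ _≡_ f × Injective _≡_ _≡_ g × (∀ i j → Adj G (f i) (g j))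

KkkFree : ℕ → PRIG → Set
KkkFree k G = ¬ ContainsKkk k G

-- Replace every point and every rectangle of a K_{2,2}-free representation by
-- k - 1 identical copies (copy q of vertex u of a side of size n is the index
-- with remQuot n = (q , u)).  Each edge uv becomes (k - 1)² edges between the
-- copies of u and those of v.  A copy of K_{k,k} in the blow-up has k vertices
-- on each side, so by pigeonhole two of them on each side are copies of the
-- same original; being distinct, they are copies of two distinct originals,
-- and these 2 + 2 originals form a K_{2,2} in the original graph.
module Submission where

open import Defs
open import Data.Nat using (ℕ; zero; suc; _+_; _*_; _∸_; _≤_)
open import Data.Nat.Properties
  using (*-assoc; *-distribˡ-+; n<1+n; +-commutativeSemigroup)
open import Data.Fin using (Fin; _↑ˡ_; _↑ʳ_; remQuot; quotient; remainder; combine)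
  renaming (zero to fzero; suc to fsuc)
open import Data.Fin.Properties
  using (splitAt-↑ʳ; remQuot-combine; combine-remQuot; pigeonhole; <⇒≢)
open import Data.List
  using (List; []; _∷_; _++_; map; filter; length; tabulate; allFin;
         concat; replicate; cartesianProduct)
open import Data.List.Properties
  using (filter-++; length-++; length-map; map-++; map-∘; map-tabulate;
         tabulate-cong; cartesianProductWith-distribʳ-++)
open import Data.Product using (∃; ∃₂; _×_; _,_; proj₁; proj₂; uncurry)
import Data.Product as Product
open import Data.Bool using (true; false)
open import Data.Vec.Functional using () renaming ([] to []ᵛ; _∷_ to _∷ᵛ_)
open import Level using (Level)
open import Function using (_∘_; id)
open import Function.Definitions using (Injective)
open import Relation.Nullary using (does; contradiction)
open import Relation.Unary using (Pred; Decidable)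
open import Relation.Binary.PropositionalEquality
open import Algebra.Properties.CommutativeSemigroup +-commutativeSemigroup
  using (interchange)

private
  variable
    ℓ : Level
    A B A′ B′ : Set

filter-map : {P : Pred B ℓ} (P? : Decidable P) (f : A → B) (xs : List A) →
             filter P? (map f xs) ≡ map f (filter (P? ∘ f) xs)
filter-map P? f [] = refl
filter-map P? f (x ∷ xs) with does (P? (f x))
... | true  = cong (f x ∷_) (filter-map P? f xs)
... | false = filter-map P? f xs

cartesianProduct-map : (f : A → A′) (g : B → B′) (xs : List A) (ys : List B) →
  cartesianProduct (map f xs) (map g ys) ≡
  map (Product.map f g) (cartesianProduct xs ys)
cartesianProduct-map f g [] ys = refl
cartesianProduct-map f g (x ∷ xs) ys = begin
  map (f x ,_) (map g ys) ++ cartesianProduct (map f xs) (map g ys)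
    ≡⟨ cong₂ _++_ (trans (sym (map-∘ ys)) (map-∘ ys)) (cartesianProduct-map f g xs ys) ⟩
  map (Product.map f g) (map (x ,_) ys) ++ map (Product.map f g) (cartesianProduct xs ys)
    ≡⟨ map-++ (Product.map f g) (map (x ,_) ys) _ ⟨
  map (Product.map f g) (map (x ,_) ys ++ cartesianProduct xs ys) ∎
  where open ≡-Reasoning

pairCount : {P : Pred (A × B) ℓ} → Decidable P → List A → List B → ℕ
pairCount P? xs ys = length (filter P? (cartesianProduct xs ys))

pairCount-map : {P : Pred (A′ × B′) ℓ} (P? : Decidable P)
  (f : A → A′) (g : B → B′) (xs : List A) (ys : List B) →
  pairCount (P? ∘ Product.map f g) xs ys ≡ pairCount P? (map f xs) (map g ys)
pairCount-map P? f g xs ys = begin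
  length (filter (P? ∘ Product.map f g) (cartesianProduct xs ys))
    ≡⟨ length-map (Product.map f g) (filter (P? ∘ Product.map f g) (cartesianProduct xs ys)) ⟨
  length (map (Product.map f g) (filter (P? ∘ Product.map f g) (cartesianProduct xs ys)))
    ≡⟨ cong length (filter-map P? (Product.map f g) (cartesianProduct xs ys)) ⟨
  length (filter P? (map (Product.map f g) (cartesianProduct xs ys)))
    ≡⟨ cong (length ∘ filter P?) (cartesianProduct-map f g xs ys) ⟨
  length (filter P? (cartesianProduct (map f xs) (map g ys))) ∎
  where open ≡-Reasoning

module _ {P : Pred (A × B) ℓ} (P? : Decidable P) where

  private
    length-filter-++ : ∀ us vs →
      length (filter P? (us ++ vs)) ≡ length (filter P? us) + length (filter P? vs)
    length-filter-++ us vs = trans (cong length (filter-++ P? us vs)) (length-++ (filter P? us))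

  pairCount-++ˡ : ∀ xs xs′ ys →
    pairCount P? (xs ++ xs′) ys ≡ pairCount P? xs ys + pairCount P? xs′ ys
  pairCount-++ˡ xs xs′ ys = trans
    (cong (length ∘ filter P?) (cartesianProductWith-distribʳ-++ _,_ xs xs′ ys))
    (length-filter-++ (cartesianProduct xs ys) _)

  pairCount-++ʳ : ∀ xs ys ys′ →
    pairCount P? xs (ys ++ ys′) ≡ pairCount P? xs ys + pairCount P? xs ys′
  pairCount-++ʳ [] ys ys′ = refl
  pairCount-++ʳ (x ∷ xs) ys ys′ = begin
    pairCount P? (x ∷ xs) (ys ++ ys′)
      ≡⟨ length-filter-++ (map (x ,_) (ys ++ ys′)) _ ⟩
    row (ys ++ ys′) + pairCount P? xs (ys ++ ys′)
      ≡⟨ cong₂ _+_ row-++ (pairCount-++ʳ xs ys ys′) ⟩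
    (row ys + row ys′) + (pairCount P? xs ys + pairCount P? xs ys′)
      ≡⟨ interchange (row ys) (row ys′) _ _ ⟩
    (row ys + pairCount P? xs ys) + (row ys′ + pairCount P? xs ys′)
      ≡⟨ cong₂ _+_ (length-filter-++ (map (x ,_) ys) _) (length-filter-++ (map (x ,_) ys′) _) ⟨
    pairCount P? (x ∷ xs) ys + pairCount P? (x ∷ xs) ys′ ∎
    where
    open ≡-Reasoning
    row : List B → ℕ
    row vs = length (filter P? (map (x ,_) vs))
    row-++ : row (ys ++ ys′) ≡ row ys + row ys′
    row-++ = trans (cong (length ∘ filter P?) (map-++ (x ,_) ys ys′))
                   (length-filter-++ (map (x ,_) ys) _)

  pairCount-replicateˡ : ∀ c xs ys →
    pairCount P? (concat (replicate c xs)) ys ≡ c * pairCount P? xs ys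
  pairCount-replicateˡ zero xs ys = refl
  pairCount-replicateˡ (suc c) xs ys = trans (pairCount-++ˡ xs _ ys)
    (cong (pairCount P? xs ys +_) (pairCount-replicateˡ c xs ys))

  pairCount-[]ʳ : ∀ xs → pairCount P? xs [] ≡ 0
  pairCount-[]ʳ [] = refl
  pairCount-[]ʳ (x ∷ xs) = pairCount-[]ʳ xs

  pairCount-replicateʳ : ∀ c xs ys →
    pairCount P? xs (concat (replicate c ys)) ≡ c * pairCount P? xs ys
  pairCount-replicateʳ zero xs ys = pairCount-[]ʳ xs
  pairCount-replicateʳ (suc c) xs ys = trans (pairCount-++ʳ xs ys _)
    (cong (pairCount P? xs ys +_) (pairCount-replicateʳ c xs ys))

tabulate-↑ˡ-↑ʳ : ∀ m {n} (f : Fin (m + n) → A) →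
  tabulate f ≡ tabulate (f ∘ (_↑ˡ n)) ++ tabulate (f ∘ (m ↑ʳ_))
tabulate-↑ˡ-↑ʳ zero f = refl
tabulate-↑ˡ-↑ʳ (suc m) f = cong (f fzero ∷_) (tabulate-↑ˡ-↑ʳ m (f ∘ fsuc))

remainder-↑ˡ : ∀ {c} n (i : Fin n) → remainder {suc c} n (i ↑ˡ (c * n)) ≡ i
remainder-↑ˡ n i = cong proj₂ (remQuot-combine fzero i)

remainder-↑ʳ : ∀ {c} n (i : Fin (c * n)) → remainder {suc c} n (n ↑ʳ i) ≡ remainder {c} n i
remainder-↑ʳ {c} n i rewrite splitAt-↑ʳ n (c * n) i = refl

tabulate-remainder : ∀ c n → tabulate (remainder {c} n) ≡ concat (replicate c (allFin n))
tabulate-remainder zero n = refl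
tabulate-remainder (suc c) n = begin
  tabulate (remainder {suc c} n)
    ≡⟨ tabulate-↑ˡ-↑ʳ n (remainder {suc c} n) ⟩
  tabulate (remainder {suc c} n ∘ (_↑ˡ (c * n))) ++ tabulate (remainder {suc c} n ∘ (n ↑ʳ_))
    ≡⟨ cong₂ _++_ (tabulate-cong (remainder-↑ˡ {c} n)) (tabulate-cong (remainder-↑ʳ {c} n)) ⟩
  allFin n ++ tabulate (remainder {c} n)
    ≡⟨ cong (allFin n ++_) (tabulate-remainder c n) ⟩
  allFin n ++ concat (replicate c (allFin n)) ∎
  where open ≡-Reasoning

remQuot-injective : ∀ {c} n → Injective _≡_ _≡_ (remQuot {c} n)
remQuot-injective {c} n {i} {j} eq = begin
  i                                 ≡⟨ combine-remQuot {c} n i ⟨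
  uncurry combine (remQuot {c} n i) ≡⟨ cong (uncurry combine) eq ⟩
  uncurry combine (remQuot {c} n j) ≡⟨ combine-remQuot {c} n j ⟩
  j                                 ∎
  where open ≡-Reasoning

pigeonhole-remainder : ∀ {c} n (f : Fin (suc c) → Fin (c * n)) → Injective _≡_ _≡_ f →
  ∃₂ λ i j → remainder {c} n (f i) ≢ remainder {c} n (f j)
pigeonhole-remainder {c} n f f-injective
  with i , j , i<j , same-block ← pigeonhole (n<1+n c) (quotient n ∘ f)
  = i , j , λ same-remainder →
      <⇒≢ i<j (f-injective (remQuot-injective n (cong₂ _,_ same-block same-remainder)))

distinct⇒Fin2-injective : (v : Fin 2 → A) → v fzero ≢ v (fsuc fzero) → Injective _≡_ _≡_ v
distinct⇒Fin2-injective v v₀≢v₁ {fzero}      {fzero}      _  = refl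
distinct⇒Fin2-injective v v₀≢v₁ {fzero}      {fsuc fzero} eq = contradiction eq v₀≢v₁
distinct⇒Fin2-injective v v₀≢v₁ {fsuc fzero} {fzero}      eq = contradiction (sym eq) v₀≢v₁
distinct⇒Fin2-injective v v₀≢v₁ {fsuc fzero} {fsuc fzero} _  = refl

blowUp : ℕ → PRIG → PRIG
blowUp c G = record
  { a     = c * a G
  ; b     = c * b G
  ; point = point G ∘ remainder {c} (a G)
  ; box   = box G ∘ remainder {c} (b G)
  }

numVertices-blowUp : ∀ c G → numVertices (blowUp c G) ≡ c * numVertices G
numVertices-blowUp c G = sym (*-distribˡ-+ c (a G) (b G))

numEdges-blowUp : ∀ c G → numEdges (blowUp c G) ≡ c * c * numEdges G
numEdges-blowUp c G = begin
  numEdges (blowUp c G)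
    ≡⟨ pairCount-map adjacent? (remainder {c} (a G)) (remainder {c} (b G))
                   (allFin (c * a G)) (allFin (c * b G)) ⟩
  pairCount adjacent? (map (remainder {c} (a G)) (allFin (c * a G)))
                      (map (remainder {c} (b G)) (allFin (c * b G)))
    ≡⟨ cong₂ (pairCount adjacent?) (copies (a G)) (copies (b G)) ⟩
  pairCount adjacent? (concat (replicate c (allFin (a G))))
                      (concat (replicate c (allFin (b G))))
    ≡⟨ pairCount-replicateˡ adjacent? c (allFin (a G)) _ ⟩
  c * pairCount adjacent? (allFin (a G)) (concat (replicate c (allFin (b G))))
    ≡⟨ cong (c *_) (pairCount-replicateʳ adjacent? c (allFin (a G)) (allFin (b G))) ⟩
  c * (c * numEdges G)
    ≡⟨ *-assoc c c _ ⟨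
  c * c * numEdges G ∎
  where
  open ≡-Reasoning
  adjacent? : Decidable (λ (e : Fin (a G) × Fin (b G)) → Adj G (proj₁ e) (proj₂ e))
  adjacent? e = point G (proj₁ e) ∈R? box G (proj₂ e)
  copies : ∀ n → map (remainder {c} n) (allFin (c * n)) ≡ concat (replicate c (allFin n))
  copies n = trans (map-tabulate id (remainder {c} n)) (tabulate-remainder c n)

KkkFree-blowUp : ∀ c G → KkkFree 2 G → KkkFree (suc c) (blowUp c G)
KkkFree-blowUp c G K₂₂-free (f , g , f-injective , g-injective , adjacent)
  with i  , j  , fi≢fj ← pigeonhole-remainder {c} (a G) f f-injective
     | i′ , j′ , gi≢gj ← pigeonhole-remainder {c} (b G) g g-injective
  = let u = remainder {c} (a G) ∘ f ∘ (i ∷ᵛ j ∷ᵛ []ᵛ)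
        v = remainder {c} (b G) ∘ g ∘ (i′ ∷ᵛ j′ ∷ᵛ []ᵛ)
    in K₂₂-free ( u , v
                , distinct⇒Fin2-injective u fi≢fj
                , distinct⇒Fin2-injective v gi≢gj
                , λ x y → adjacent ((i ∷ᵛ j ∷ᵛ []ᵛ) x) ((i′ ∷ᵛ j′ ∷ᵛ []ᵛ) y) )

lemma36 : (k : ℕ) → 1 ≤ k → (n m : ℕ) →
    (∃ λ (G : PRIG) → KkkFree 2 G × numVertices G ≡ n × numEdges G ≡ m) →
    ∃ λ (H : PRIG) → KkkFree k H × numVertices H ≡ (k ∸ 1) * n
    × numEdges H ≡ (k ∸ 1) * (k ∸ 1) * m
lemma36 (suc c) _ n m (G , K₂₂-free , refl , refl) =
  blowUp c G , KkkFree-blowUp c G K₂₂-free , numVertices-blowUp c G , numEdges-blowUp c G
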